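{- Let $T$ be a tree. Then $$H_e(T,x) = \frac{1}{x}H(T,x) - \frac{|V(T)|}{x},$$ equivalently $H(T,x) = xH_e(T,x) + |V(T)|$, where $H(T,x)$ is the Hosoya polynomial and $H_e(T,x)$ the edge-Hosoya polynomial of $T$.
   Context: For a connected graph $G$ and $k\ge 0$, $d(G,k)$ is the number of unordered pairs of vertices of $G$ at distance $k$ (for $k=0$ this counts each vertex paired with itself, so $d(G,0)=|V(G)|$), and the Hosoya polynomial is $H(G,x)=\sum_{k\ge0} d(G,k)x^k$. The distance $d(e,f)$ between edges $e,f$ is their distance as vertices of the line graph $L(G)$; $d_e(G,k)$ is the number of unordered pairs of edges at distance $k$ (with $d_e(G,0)=|E(G)|$), and the edge-Hosoya polynomial is $H_e(G,x)=\sum_{k\ge0} d_e(G,k)x^k$, i.e. $H_e(G,x)=H(L(G),x)$. -}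

module Defs where

open import Data.Nat using (ℕ; zero; suc; _+_; _≤_; _<ᵇ_; _≤ᵇ_)
open import Data.Bool using (Bool; true; false; _∧_; _∨_; not; if_then_else_)
open import Data.Fin using (Fin; toℕ; _≟_)
open import Data.List using (List; []; _∷_; _++_; [_]; length; lookup; allFin; concatMap; foldr)
open import Data.List.Relation.Unary.Linked using (Linked)
open import Data.List.Relation.Unary.Unique.Propositional using (Unique)
open import Data.Product using (Σ; _×_; _,_; ∃)
open import Relation.Nullary using (¬_)
open import Relation.Nullary.Decidable using (⌊_⌋)
open import Relation.Binary.PropositionalEquality using (_≡_)

Graph : ℕ → Set
Graph n = Fin n → Fin n → Bool

Adj : ∀ {n} → Graph n → Fin n → Fin n → Set
Adj G u v = G u v ≡ true

IsSimple : ∀ {n} → Graph n → Set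
IsSimple {n} G = (∀ u v → G u v ≡ G v u) × (∀ u → G u u ≡ false)

anyFin : ∀ n → (Fin n → Bool) → Bool
anyFin n p = foldr (λ x b → p x ∨ b) false (allFin n)

-- reach G k u v = true  iff there is a walk from u to v of length ≤ k
reach : ∀ {n} → Graph n → ℕ → Fin n → Fin n → Bool
reach G zero    u v = ⌊ u ≟ v ⌋
reach {n} G (suc k) u v = reach G k u v ∨ anyFin n (λ w → reach G k u w ∧ G w v)

distAt : ∀ {n} → Graph n → ℕ → Fin n → Fin n → Bool
distAt G zero    u v = reach G zero u v
distAt G (suc k) u v = reach G (suc k) u v ∧ not (reach G k u v)

Connected : ∀ {n} → Graph n → Set
Connected G = ∀ u v → ∃ λ k → reach G k u v ≡ true

IsCycle : ∀ {n} → Graph n → Fin n → List (Fin n) → Set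
IsCycle G v rest = (2 ≤ length rest) × Unique (v ∷ rest) × Linked (Adj G) (v ∷ rest ++ [ v ])

Acyclic : ∀ {n} → Graph n → Set
Acyclic {n} G = ¬ (Σ (Fin n) λ v → Σ (List (Fin n)) λ rest → IsCycle G v rest)

IsTree : ∀ {n} → Graph n → Set
IsTree G = IsSimple G × Connected G × Acyclic G

countTrue : List Bool → ℕ
countTrue = foldr (λ b m → if b then suc m else m) 0

-- unordered pairs {u,v} (u = v allowed), represented by (u,v) with toℕ u ≤ toℕ v
unorderedPairs : ∀ n → List (Fin n × Fin n)
unorderedPairs n = concatMap (λ u → concatMap (λ v → if toℕ u ≤ᵇ toℕ v then [ (u , v) ] else []) (allFin n)) (allFin n)

d : ∀ {n} → Graph n → ℕ → ℕ
d {n} G k = countTrue (Data.List.map (λ p → distAt G k (Data.Product.proj₁ p) (Data.Product.proj₂ p)) (unorderedPairs n))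

-- Polynomials with ℕ coefficients, represented by their coefficient sequence.
Poly : Set
Poly = ℕ → ℕ

H : ∀ {n} → Graph n → Poly
H G = d G

X* : Poly → Poly
X* p zero    = 0
X* p (suc k) = p k

_+C_ : Poly → ℕ → Poly
(p +C c) zero    = p zero + c
(p +C c) (suc k) = p (suc k)

edges : ∀ {n} → Graph n → List (Fin n × Fin n)
edges {n} G = concatMap (λ u → concatMap (λ v → if (toℕ u <ᵇ toℕ v) ∧ G u v then [ (u , v) ] else []) (allFin n)) (allFin n)

eqF : ∀ {n} → Fin n → Fin n → Bool
eqF u v = ⌊ u ≟ v ⌋

shareEnd : ∀ {n} → Fin n × Fin n → Fin n × Fin n → Bool
shareEnd (a , b) (c , e) = eqF a c ∨ eqF a e ∨ eqF b c ∨ eqF b e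

L : ∀ {n} (G : Graph n) → Graph (length (edges G))
L G i j = not (eqF i j) ∧ shareEnd (lookup (edges G) i) (lookup (edges G) j)

He : ∀ {n} → Graph n → Poly
He G = H (L G)

-- In a tree, the distance in L(T) between two distinct edges is one more than the least
-- distance between their endpoints, and one less than the greatest.  So if d(u,v) = k + 2,
-- the edges at the two ends of the u–v path are at distance k + 1 in L(T), and conversely
-- every ordered pair of edges at distance k + 1 arises from exactly one ordered pair (u , v)
-- in this way: their far endpoints.  Counting ordered pairs (twice the unordered ones) gives
-- d(T,k+2) = d_e(T,k+1); moreover d(T,1) = |E(T)| = d_e(T,0) and d(T,0) = |V(T)|.
-- The tree facts needed all follow from one consequence of acyclicity: two distinct vertices
-- at the same distance k from s cannot be joined by a path staying farther than k from s.

module Submission where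

open import Defs
open import Data.Nat using (ℕ)
open import Relation.Binary.PropositionalEquality using (_≡_)

open import Data.Bool using (Bool; true; false; _∧_; _∨_; not; if_then_else_)
open import Data.Bool.Properties using (∧-zeroʳ; ∧-conicalˡ; ∧-conicalʳ; ∨-zeroʳ; T-≡; not-¬)
open import Data.Empty using (⊥; ⊥-elim)
import Data.Fin as Fin
open import Data.Fin using (Fin; toℕ; _≟_; punchIn)
open import Data.Fin.Properties using (toℕ-injective; punchInᵢ≢i)
open import Data.List using (List; []; _∷_; _++_; [_]; length; lookup; concatMap; foldr; tabulate; map)
open import Data.List.Properties using (map-++; length-++)
open import Data.Nat using (zero; suc; _+_; _*_; _≤_; _≰_; _<_; z≤n; s≤s; _≤ᵇ_; _<ᵇ_; _≤?_)
open import Data.Nat.Properties hiding (_≟_)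
open import Data.List.Relation.Unary.All as All using (All; []; _∷_)
import Data.List.Relation.Unary.All.Properties as All
open import Data.List.Relation.Unary.AllPairs using ([]; _∷_)
import Data.List.Relation.Unary.AllPairs.Properties as AllPairs
open import Data.List.Relation.Unary.Linked using (Linked; []; [-]; _∷_)
open import Data.List.Relation.Unary.Unique.Propositional using (Unique)
open import Data.List.Relation.Unary.Unique.Propositional.Properties using (allFin⁺)
open import Data.List.Relation.Unary.Any as Any using (Any; here)
import Data.List.Relation.Unary.Any.Properties as Any
open import Data.List.Membership.Propositional.Properties using (∈-lookup)
open import Data.Product using (_×_; _,_; ∃; ∃₂; proj₁; proj₂)
open import Data.Sum using (_⊎_; inj₁; inj₂)
open import Function using (_∘_; Equivalence)
open import Relation.Binary.Definitions using (tri<; tri≈; tri>)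
open import Relation.Binary.PropositionalEquality using (_≢_; refl; sym; trans; cong; cong₂; subst; subst₂; module ≡-Reasoning)
open import Relation.Nullary using (yes; no; Dec)
open import Relation.Nullary.Decidable using (toWitness)

open import Algebra.Properties.CommutativeMonoid.Sum +-0-commutativeMonoid
  using (sum; sum-syntax; sum-cong-≗; sum-remove; sum-replicate-zero; ∑-distrib-+; ∑-comm)

∧-true-elim : ∀ a b → a ∧ b ≡ true → a ≡ true × b ≡ true
∧-true-elim a b h = ∧-conicalˡ a b h , ∧-conicalʳ a b h

∧-true-intro : ∀ {a b} → a ≡ true → b ≡ true → a ∧ b ≡ true
∧-true-intro refl refl = refl

∨-true-elim : ∀ a b → a ∨ b ≡ true → a ≡ true ⊎ b ≡ true
∨-true-elim true  b h = inj₁ refl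
∨-true-elim false b h = inj₂ h

∨-true-introˡ : ∀ {a} b → a ≡ true → a ∨ b ≡ true
∨-true-introˡ b refl = refl

∨-true-introʳ : ∀ a {b} → b ≡ true → a ∨ b ≡ true
∨-true-introʳ a refl = ∨-zeroʳ a

not-true-elim : ∀ {a} → not a ≡ true → a ≡ false
not-true-elim {false} _ = refl

≢true⇒≡false : ∀ {a} → a ≢ true → a ≡ false
≢true⇒≡false {true}  h = ⊥-elim (h refl)
≢true⇒≡false {false} h = refl

true-ext : ∀ {a b} → (a ≡ true → b ≡ true) → (b ≡ true → a ≡ true) → a ≡ b
true-ext {true}  {true}  f g = refl
true-ext {true}  {false} f g = sym (f refl)
true-ext {false} {true}  f g = g refl
true-ext {false} {false} f g = refl

eqF⇒≡ : ∀ {n} {u v : Fin n} → eqF u v ≡ true → u ≡ v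
eqF⇒≡ h = toWitness (Equivalence.from T-≡ h)

≡⇒eqF : ∀ {n} {u v : Fin n} → u ≡ v → eqF u v ≡ true
≡⇒eqF {u = u} {v} u≡v with u ≟ v
... | yes _   = refl
... | no u≢v = ⊥-elim (u≢v u≡v)

≢⇒eqF : ∀ {n} {u v : Fin n} → u ≢ v → eqF u v ≡ false
≢⇒eqF {u = u} {v} u≢v with u ≟ v
... | yes u≡v = ⊥-elim (u≢v u≡v)
... | no _    = refl

≤⇒≤ᵇ≡true : ∀ {m n} → m ≤ n → (m ≤ᵇ n) ≡ true
≤⇒≤ᵇ≡true = Equivalence.to T-≡ ∘ ≤⇒≤ᵇ

≤ᵇ≡true⇒≤ : ∀ m n → (m ≤ᵇ n) ≡ true → m ≤ n
≤ᵇ≡true⇒≤ m n = ≤ᵇ⇒≤ m n ∘ Equivalence.from T-≡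

<⇒<ᵇ≡true : ∀ {m n} → m < n → (m <ᵇ n) ≡ true
<⇒<ᵇ≡true = Equivalence.to T-≡ ∘ <⇒<ᵇ

<ᵇ≡true⇒< : ∀ m n → (m <ᵇ n) ≡ true → m < n
<ᵇ≡true⇒< m n = <ᵇ⇒< m n ∘ Equivalence.from T-≡

-- Counting pairs

indicator : Bool → ℕ
indicator true  = 1
indicator false = 0

indicator-≢true : ∀ {b} → b ≢ true → indicator b ≡ 0
indicator-≢true h = cong indicator (≢true⇒≡false h)

∑-zero : ∀ {n} {f : Fin n → ℕ} → (∀ i → f i ≡ 0) → ∑[ i < n ] f i ≡ 0
∑-zero {n} h = trans (sum-cong-≗ h) (sum-replicate-zero n)

∑-single : ∀ {n} (f : Fin n → ℕ) i → (∀ j → j ≢ i → f j ≡ 0) → ∑[ j < n ] f j ≡ f i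
∑-single {suc n} f i h = begin
  sum f                      ≡⟨ sum-remove {i = i} f ⟩
  f i + ∑[ j < n ] f (punchIn i j) ≡⟨ cong (f i +_) (∑-zero (λ j → h _ (punchInᵢ≢i i j))) ⟩
  f i + 0                    ≡⟨ +-identityʳ (f i) ⟩
  f i                        ∎
  where open ≡-Reasoning

∑-one : ∀ n → ∑[ i < n ] 1 ≡ n
∑-one zero    = refl
∑-one (suc n) = cong suc (∑-one n)

pairCount : ∀ {n} → (Fin n → Fin n → Bool) → ℕ
pairCount {n} P = ∑[ u < n ] ∑[ v < n ] indicator (P u v)

pairCount-unique : ∀ {n} (P : Fin n → Fin n → Bool) u₀ v₀ → P u₀ v₀ ≡ true →
  (∀ u v → P u v ≡ true → u ≡ u₀ × v ≡ v₀) → pairCount P ≡ 1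
pairCount-unique {n} P u₀ v₀ p₀ unique = begin
  pairCount P                      ≡⟨ ∑-single _ u₀ (λ u u≢u₀ → ∑-zero (λ v →
                                        indicator-≢true (u≢u₀ ∘ proj₁ ∘ unique u v))) ⟩
  ∑[ v < n ] indicator (P u₀ v)    ≡⟨ ∑-single _ v₀ (λ v v≢v₀ →
                                        indicator-≢true (v≢v₀ ∘ proj₂ ∘ unique u₀ v)) ⟩
  indicator (P u₀ v₀)              ≡⟨ cong indicator p₀ ⟩
  1                                ∎
  where open ≡-Reasoning

pairCount-none : ∀ {n} (P : Fin n → Fin n → Bool) → (∀ u v → P u v ≢ true) → pairCount P ≡ 0
pairCount-none P none = ∑-zero (λ u → ∑-zero (λ v → indicator-≢true (none u v)))

UniqueWitness : ∀ {n} → (Fin n → Fin n → Bool) → Set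
UniqueWitness {n} P = ∃₂ λ u₀ v₀ → P u₀ v₀ ≡ true × (∀ u v → P u v ≡ true → u ≡ u₀ × v ≡ v₀)

pairCount-indicator : ∀ {n} (P : Fin n → Fin n → Bool) b →
  (∀ u v → P u v ≡ true → b ≡ true) → (b ≡ true → UniqueWitness P) → pairCount P ≡ indicator b
pairCount-indicator P true  sound complete with complete refl
... | u₀ , v₀ , p₀ , unique = pairCount-unique P u₀ v₀ p₀ unique
pairCount-indicator P false sound complete = pairCount-none P (λ u v → (λ ()) ∘ sound u v)

∑∑∑∑-comm : ∀ {a b c d} (f : Fin a → Fin b → Fin c → Fin d → ℕ) →
  ∑[ u < a ] ∑[ v < b ] ∑[ i < c ] ∑[ j < d ] f u v i j ≡
  ∑[ i < c ] ∑[ j < d ] ∑[ u < a ] ∑[ v < b ] f u v i j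
∑∑∑∑-comm {a} {b} {c} {d} f = begin
  ∑[ u < a ] ∑[ v < b ] ∑[ i < c ] ∑[ j < d ] f u v i j
    ≡⟨ sum-cong-≗ (λ u → ∑-comm (λ v i → ∑[ j < d ] f u v i j)) ⟩
  ∑[ u < a ] ∑[ i < c ] ∑[ v < b ] ∑[ j < d ] f u v i j
    ≡⟨ ∑-comm (λ u i → ∑[ v < b ] ∑[ j < d ] f u v i j) ⟩
  ∑[ i < c ] ∑[ u < a ] ∑[ v < b ] ∑[ j < d ] f u v i j
    ≡⟨ sum-cong-≗ (λ i → sum-cong-≗ (λ u → ∑-comm (λ v j → f u v i j))) ⟩
  ∑[ i < c ] ∑[ u < a ] ∑[ j < d ] ∑[ v < b ] f u v i j
    ≡⟨ sum-cong-≗ (λ i → ∑-comm (λ u j → ∑[ v < b ] f u v i j)) ⟩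
  ∑[ i < c ] ∑[ j < d ] ∑[ u < a ] ∑[ v < b ] f u v i j
    ∎
  where open ≡-Reasoning

pairCount-double-counting : ∀ {n m} (P : Fin n → Fin n → Bool) (Q : Fin m → Fin m → Bool)
  (R : Fin n → Fin n → Fin m → Fin m → Bool) →
  (∀ u v → pairCount (R u v) ≡ indicator (P u v)) →
  (∀ i j → pairCount (λ u v → R u v i j) ≡ indicator (Q i j)) →
  pairCount P ≡ pairCount Q
pairCount-double-counting {n} {m} P Q R rowP columnQ = begin
  pairCount P
    ≡⟨ sum-cong-≗ (λ u → sum-cong-≗ (λ v → sym (rowP u v))) ⟩
  ∑[ u < n ] ∑[ v < n ] ∑[ i < m ] ∑[ j < m ] indicator (R u v i j)
    ≡⟨ ∑∑∑∑-comm (λ u v i j → indicator (R u v i j)) ⟩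
  ∑[ i < m ] ∑[ j < m ] ∑[ u < n ] ∑[ v < n ] indicator (R u v i j)
    ≡⟨ sum-cong-≗ (λ i → sum-cong-≗ (λ j → columnQ i j)) ⟩
  pairCount Q
    ∎
  where open ≡-Reasoning

Upper : ∀ {n} → (Fin n → Fin n → Bool) → Fin n → Fin n → Bool
Upper P u v = (toℕ u ≤ᵇ toℕ v) ∧ P u v

pairCount-symmetric : ∀ {n} (P : Fin n → Fin n → Bool) →
  (∀ u v → P u v ≡ P v u) → (∀ u → P u u ≡ false) →
  pairCount P ≡ 2 * pairCount (Upper P)
pairCount-symmetric {n} P P-sym P-irrefl = begin
  pairCount P                                        ≡⟨ sum-cong-≗ (λ u → sum-cong-≗ (split u)) ⟩
  ∑[ u < n ] ∑[ v < n ] (A u v + A v u)              ≡⟨ sum-cong-≗ (λ u → ∑-distrib-+ (A u) (λ v → A v u)) ⟩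
  ∑[ u < n ] (∑[ v < n ] A u v + ∑[ v < n ] A v u)   ≡⟨ ∑-distrib-+ (λ u → ∑[ v < n ] A u v) _ ⟩
  pairCount (Upper P) + ∑[ u < n ] ∑[ v < n ] A v u  ≡⟨ cong (pairCount (Upper P) +_) (∑-comm (λ u v → A v u)) ⟩
  pairCount (Upper P) + pairCount (Upper P)          ≡⟨ cong (pairCount (Upper P) +_) (sym (+-identityʳ _)) ⟩
  2 * pairCount (Upper P)                            ∎
  where
  open ≡-Reasoning
  A : Fin n → Fin n → ℕ
  A u v = indicator (Upper P u v)
  ≤ᵇ-false : ∀ {a b} → b < a → (a ≤ᵇ b) ≡ false
  ≤ᵇ-false {a} {b} b<a = ≢true⇒≡false (<⇒≱ b<a ∘ ≤ᵇ≡true⇒≤ a b)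
  split : ∀ u v → indicator (P u v) ≡ A u v + A v u
  split u v with <-cmp (toℕ u) (toℕ v)
  ... | tri< u<v _ _ rewrite ≤⇒≤ᵇ≡true (<⇒≤ u<v) | ≤ᵇ-false u<v = sym (+-identityʳ _)
  ... | tri> _ _ v<u rewrite ≤⇒≤ᵇ≡true (<⇒≤ v<u) | ≤ᵇ-false v<u | P-sym u v = refl
  ... | tri≈ _ u≡v _ with toℕ-injective u≡v
  ...   | refl rewrite P-irrefl u | ≤⇒≤ᵇ≡true (≤-refl {toℕ u}) = refl

countTrue-++ : ∀ (bs cs : List Bool) → countTrue (bs ++ cs) ≡ countTrue bs + countTrue cs
countTrue-++ []           cs = refl
countTrue-++ (true ∷ bs)  cs = cong suc (countTrue-++ bs cs)
countTrue-++ (false ∷ bs) cs = countTrue-++ bs cs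

countTrue-concatMap : ∀ {A B : Set} {n} (P : A → Bool) (g : B → List A) (h : Fin n → B) →
  countTrue (map P (concatMap g (tabulate h))) ≡ ∑[ i < n ] countTrue (map P (g (h i)))
countTrue-concatMap {n = zero}  P g h = refl
countTrue-concatMap {A = A} {n = suc n} P g h = begin
  countTrue (map P (g (h Fin.zero) ++ rest))            ≡⟨ cong countTrue (map-++ P (g (h Fin.zero)) rest) ⟩
  countTrue (map P (g (h Fin.zero)) ++ map P rest)      ≡⟨ countTrue-++ (map P (g (h Fin.zero))) _ ⟩
  countTrue (map P (g (h Fin.zero))) + countTrue (map P rest)
                                                        ≡⟨ cong (countTrue (map P (g (h Fin.zero))) +_)
                                                                (countTrue-concatMap P g (h ∘ Fin.suc)) ⟩
  ∑[ i < suc n ] countTrue (map P (g (h i)))            ∎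
  where
  open ≡-Reasoning
  rest : List A
  rest = concatMap g (tabulate (h ∘ Fin.suc))

length-concatMap : ∀ {A B : Set} {n} (g : B → List A) (h : Fin n → B) →
  length (concatMap g (tabulate h)) ≡ ∑[ i < n ] length (g (h i))
length-concatMap {n = zero}  g h = refl
length-concatMap {n = suc n} g h =
  trans (length-++ (g (h Fin.zero))) (cong (length (g (h Fin.zero)) +_) (length-concatMap g (h ∘ Fin.suc)))

countTrue-singleton? : ∀ {A : Set} (P : A → Bool) c (x : A) →
  countTrue (map P (if c then [ x ] else [])) ≡ indicator (c ∧ P x)
countTrue-singleton? P false x = refl
countTrue-singleton? P true  x with P x
... | true  = refl
... | false = refl

length-singleton? : ∀ {A : Set} c (x : A) → length (if c then [ x ] else []) ≡ indicator c
length-singleton? false x = refl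
length-singleton? true  x = refl

d≡pairCount : ∀ {n} (G : Graph n) k → d G k ≡ pairCount (Upper (distAt G k))
d≡pairCount {n} G k =
  trans (countTrue-concatMap {n = n} P _ (λ u → u))
        (sum-cong-≗ (λ u → trans (countTrue-concatMap {n = n} P _ (λ v → v))
                                 (sum-cong-≗ (λ v → countTrue-singleton? P (toℕ u ≤ᵇ toℕ v) (u , v)))))
  where
  P : Fin n × Fin n → Bool
  P p = distAt G k (proj₁ p) (proj₂ p)

|edges|≡pairCount : ∀ {n} (G : Graph n) → length (edges G) ≡ pairCount (λ u v → (toℕ u <ᵇ toℕ v) ∧ G u v)
|edges|≡pairCount {n} G =
  trans (length-concatMap {n = n} _ (λ u → u))
        (sum-cong-≗ (λ u → trans (length-concatMap {n = n} _ (λ v → v))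
                                 (sum-cong-≗ (λ v → length-singleton? ((toℕ u <ᵇ toℕ v) ∧ G u v) (u , v)))))

d-zero : ∀ {n} (G : Graph n) → d G 0 ≡ n
d-zero {n} G = begin
  d G 0
    ≡⟨ d≡pairCount G 0 ⟩
  pairCount (Upper (distAt G 0))
    ≡⟨ sum-cong-≗ (λ u → ∑-single (λ v → indicator (Upper (distAt G 0) u v)) u
                                  (λ v v≢u → cong indicator (off-diagonal u v v≢u))) ⟩
  ∑[ u < n ] indicator (Upper (distAt G 0) u u)
    ≡⟨ sum-cong-≗ {n} (λ u → cong indicator (∧-true-intro (≤⇒≤ᵇ≡true (≤-refl {toℕ u})) (≡⇒eqF refl))) ⟩
  ∑[ u < n ] 1
    ≡⟨ ∑-one n ⟩
  n ∎
  where
  open ≡-Reasoning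
  off-diagonal : ∀ u v → v ≢ u → Upper (distAt G 0) u v ≡ false
  off-diagonal u v v≢u = trans (cong ((toℕ u ≤ᵇ toℕ v) ∧_) (≢⇒eqF (v≢u ∘ sym))) (∧-zeroʳ _)

-- Walks and distances

any-tabulate-intro : ∀ {A : Set} {n} (p : A → Bool) (h : Fin n → A) i → p (h i) ≡ true →
  foldr (λ x b → p x ∨ b) false (tabulate h) ≡ true
any-tabulate-intro p h Fin.zero    e = ∨-true-introˡ _ e
any-tabulate-intro p h (Fin.suc i) e = ∨-true-introʳ (p (h Fin.zero)) (any-tabulate-intro p (h ∘ Fin.suc) i e)

any-tabulate-elim : ∀ {A : Set} {n} (p : A → Bool) (h : Fin n → A) →
  foldr (λ x b → p x ∨ b) false (tabulate h) ≡ true → ∃ λ i → p (h i) ≡ true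
any-tabulate-elim {n = suc n} p h e with ∨-true-elim (p (h Fin.zero)) _ e
... | inj₁ first = Fin.zero , first
... | inj₂ later with any-tabulate-elim p (h ∘ Fin.suc) later
...   | i , pi = Fin.suc i , pi

module Walks {n} (G : Graph n) where

  reach-suc⁻ : ∀ k u v → reach G (suc k) u v ≡ true →
    reach G k u v ≡ true ⊎ ∃ λ w → reach G k u w ≡ true × G w v ≡ true
  reach-suc⁻ k u v r with ∨-true-elim _ _ r
  ... | inj₁ short = inj₁ short
  ... | inj₂ long with any-tabulate-elim _ (λ x → x) long
  ...   | w , rw = inj₂ (w , ∧-true-elim _ _ rw)

  reach-suc : ∀ k u v → reach G k u v ≡ true → reach G (suc k) u v ≡ true
  reach-suc k u v = ∨-true-introˡ _

  reach-snoc : ∀ k u w v → reach G k u w ≡ true → G w v ≡ true → reach G (suc k) u v ≡ true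
  reach-snoc k u w v r a = ∨-true-introʳ (reach G k u v) (any-tabulate-intro _ (λ x → x) w (∧-true-intro r a))

  reach-mono : ∀ {k k′} u v → k ≤ k′ → reach G k u v ≡ true → reach G k′ u v ≡ true
  reach-mono {k′ = zero}   u v z≤n r = r
  reach-mono {k′ = suc k′} u v k≤k′ r with m≤n⇒m<n∨m≡n k≤k′
  ... | inj₁ k<k′ = reach-suc k′ u v (reach-mono u v (≤-pred k<k′) r)
  ... | inj₂ refl = r

  reach-refl : ∀ k u → reach G k u u ≡ true
  reach-refl k u = reach-mono {k′ = k} u u z≤n (≡⇒eqF refl)

  reach-cons : ∀ k u w v → G u w ≡ true → reach G k w v ≡ true → reach G (suc k) u v ≡ true
  reach-cons zero u w v a r with eqF⇒≡ r
  ... | refl = reach-snoc 0 u u w (reach-refl 0 u) a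
  reach-cons (suc k) u w v a r with reach-suc⁻ k w v r
  ... | inj₁ short          = reach-suc (suc k) u v (reach-cons k u w v a short)
  ... | inj₂ (x , rx , xv) = reach-snoc (suc k) u x v (reach-cons k u w x a rx) xv

  distAt-suc-irrefl : ∀ k u → distAt G (suc k) u u ≡ false
  distAt-suc-irrefl k u = trans (cong (reach G (suc k) u u ∧_) (cong not (reach-refl k u))) (∧-zeroʳ _)

  module Symmetric (G-sym : ∀ u v → G u v ≡ true → G v u ≡ true) where

    reach-sym : ∀ k u v → reach G k u v ≡ true → reach G k v u ≡ true
    reach-sym zero    u v r = ≡⇒eqF (sym (eqF⇒≡ r))
    reach-sym (suc k) u v r with reach-suc⁻ k u v r
    ... | inj₁ short          = reach-suc k v u (reach-sym k u v short)
    ... | inj₂ (w , rw , wv) = reach-cons k v w u (G-sym w v wv) (reach-sym k u w rw)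

    reach-comm : ∀ k u v → reach G k u v ≡ reach G k v u
    reach-comm k u v = true-ext (reach-sym k u v) (reach-sym k v u)

    distAt-comm : ∀ k u v → distAt G k u v ≡ distAt G k v u
    distAt-comm zero    u v = reach-comm zero u v
    distAt-comm (suc k) u v = cong₂ _∧_ (reach-comm (suc k) u v) (cong not (reach-comm k u v))

    pairCount-distAt≡2*d : ∀ k → pairCount (distAt G (suc k)) ≡ 2 * d G (suc k)
    pairCount-distAt≡2*d k =
      trans (pairCount-symmetric (distAt G (suc k)) (distAt-comm (suc k)) (distAt-suc-irrefl k))
            (cong (2 *_) (sym (d≡pairCount G (suc k))))

least : (ℕ → Bool) → ℕ → ℕ
least p zero    = 0
least p (suc K) = if p 0 then 0 else suc (least (p ∘ suc) K)

least-satisfies : ∀ (p : ℕ → Bool) K → p K ≡ true → p (least p K) ≡ true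
least-satisfies p zero    h = h
least-satisfies p (suc K) h with p 0 in p0
... | true  = p0
... | false = least-satisfies (p ∘ suc) K h

least-minimal : ∀ (p : ℕ → Bool) K i → i < least p K → p i ≡ false
least-minimal p (suc K) i i<least with p 0 in p0
least-minimal p (suc K) zero    _             | false = p0
least-minimal p (suc K) (suc i) (s≤s i<least) | false = least-minimal (p ∘ suc) K i i<least

module Distance {n} (G : Graph n) (G-sym : ∀ u v → G u v ≡ true → G v u ≡ true) (connected : Connected G) where
  open Walks G
  open Symmetric G-sym

  dist : Fin n → Fin n → ℕ
  dist u v = least (λ k → reach G k u v) (proj₁ (connected u v))

  reach-dist : ∀ u v → reach G (dist u v) u v ≡ true
  reach-dist u v = least-satisfies (λ k → reach G k u v) (proj₁ (connected u v)) (proj₂ (connected u v))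

  reach-<dist : ∀ {k} u v → k < dist u v → reach G k u v ≡ false
  reach-<dist {k} u v = least-minimal (λ k → reach G k u v) (proj₁ (connected u v)) k

  reach⇒dist≤ : ∀ {k} u v → reach G k u v ≡ true → dist u v ≤ k
  reach⇒dist≤ {k} u v r with dist u v ≤? k
  ... | yes d≤k = d≤k
  ... | no  d≰k = ⊥-elim (not-¬ r (reach-<dist u v (≰⇒> d≰k)))

  dist≤⇒reach : ∀ {k} u v → dist u v ≤ k → reach G k u v ≡ true
  dist≤⇒reach u v d≤k = reach-mono u v d≤k (reach-dist u v)

  distAt⇒dist≡ : ∀ k u v → distAt G k u v ≡ true → dist u v ≡ k
  distAt⇒dist≡ zero    u v r = n≤0⇒n≡0 (reach⇒dist≤ u v r)
  distAt⇒dist≡ (suc k) u v r with ∧-true-elim _ _ r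
  ... | within , not-within = ≤-antisym (reach⇒dist≤ u v within) (≰⇒> k≱d)
    where
    k≱d : dist u v ≰ k
    k≱d d≤k = not-¬ (dist≤⇒reach u v d≤k) (not-true-elim not-within)

  dist≡⇒distAt : ∀ k u v → dist u v ≡ k → distAt G k u v ≡ true
  dist≡⇒distAt zero    u v d≡0   = subst (λ j → reach G j u v ≡ true) d≡0 (reach-dist u v)
  dist≡⇒distAt (suc k) u v d≡1+k =
    ∧-true-intro (subst (λ j → reach G j u v ≡ true) d≡1+k (reach-dist u v))
                 (cong not (reach-<dist u v (≤-reflexive (sym d≡1+k))))

  dist-comm : ∀ u v → dist u v ≡ dist v u
  dist-comm u v = ≤-antisym (reach⇒dist≤ u v (reach-sym (dist v u) v u (reach-dist v u)))
                            (reach⇒dist≤ v u (reach-sym (dist u v) u v (reach-dist u v)))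

  dist-refl : ∀ u → dist u u ≡ 0
  dist-refl u = n≤0⇒n≡0 (reach⇒dist≤ u u (reach-refl 0 u))

  dist≡0⇒≡ : ∀ u v → dist u v ≡ 0 → u ≡ v
  dist≡0⇒≡ u v d≡0 = eqF⇒≡ (subst (λ k → reach G k u v ≡ true) d≡0 (reach-dist u v))

  dist-step : ∀ x {a b} → G a b ≡ true → dist x b ≤ suc (dist x a)
  dist-step x {a} {b} ab = reach⇒dist≤ x b (reach-snoc (dist x a) x a b (reach-dist x a) ab)

  dist-suc⇒predecessor : ∀ u v {k} → dist u v ≡ suc k → ∃ λ w → G w v ≡ true × dist u w ≡ k
  dist-suc⇒predecessor u v {k} d≡1+k
    with reach-suc⁻ k u v (subst (λ j → reach G j u v ≡ true) d≡1+k (reach-dist u v))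
  ... | inj₁ short = ⊥-elim (not-¬ short (reach-<dist u v (≤-reflexive (sym d≡1+k))))
  ... | inj₂ (w , rw , wv) =
    w , wv , ≤-antisym (reach⇒dist≤ u w rw) (≤-pred (subst (_≤ suc (dist u w)) d≡1+k (dist-step u wv)))

-- Trees

Linked-snoc : ∀ {A : Set} {R : A → A → Set} (xs : List A) {a b} →
  Linked R (xs ++ [ a ]) → R a b → Linked R ((xs ++ [ a ]) ++ [ b ])
Linked-snoc []           [-]        r = r ∷ [-]
Linked-snoc (x ∷ [])     (r′ ∷ rs)  r = r′ ∷ Linked-snoc [] rs r
Linked-snoc (x ∷ y ∷ xs) (r′ ∷ rs)  r = r′ ∷ Linked-snoc (y ∷ xs) rs r

Unique-snoc : ∀ {A : Set} {xs : List A} {a} → Unique xs → All (_≢ a) xs → Unique (xs ++ [ a ])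
Unique-snoc unique xs≢a = AllPairs.++⁺ unique ([] ∷ []) (All.map (_∷ []) xs≢a)

2≤length-∷-++-[_] : ∀ {A : Set} (x : A) xs y → 2 ≤ length (x ∷ xs ++ [ y ])
2≤length-∷-++-[_] x []      y = s≤s (s≤s z≤n)
2≤length-∷-++-[_] x (_ ∷ _) y = s≤s (s≤s z≤n)

m≤1+n⇒n≤1+m⇒m≢n⇒n≡1+m⊎m≡1+n : ∀ {m n} → m ≤ suc n → n ≤ suc m → m ≢ n → n ≡ suc m ⊎ m ≡ suc n
m≤1+n⇒n≤1+m⇒m≢n⇒n≡1+m⊎m≡1+n m≤1+n n≤1+m m≢n with m≤n⇒m<n∨m≡n m≤1+n
... | inj₂ m≡1+n = inj₂ m≡1+n
... | inj₁ m<1+n = inj₁ (≤-antisym n≤1+m (≤∧≢⇒< (≤-pred m<1+n) m≢n))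

n≢2+n : ∀ n → n ≢ suc (suc n)
n≢2+n n = <⇒≢ (m<n⇒m<1+n (n<1+n n))

module Simple {n} (G : Graph n) (simple : IsSimple G) where

  adjacent-sym : ∀ u v → G u v ≡ true → G v u ≡ true
  adjacent-sym u v = trans (proj₁ simple v u)

  adjacent⇒≢ : ∀ {u v} → G u v ≡ true → u ≢ v
  adjacent⇒≢ {u} uv refl = not-¬ uv (proj₂ simple u)

  open Walks G

  distAt-one : ∀ u v → distAt G 1 u v ≡ G u v
  distAt-one u v = true-ext at-one⇒adjacent adjacent⇒at-one
    where
    at-one⇒adjacent : distAt G 1 u v ≡ true → G u v ≡ true
    at-one⇒adjacent h with ∧-true-elim _ _ h
    ... | within , not-equal with reach-suc⁻ 0 u v within
    ...   | inj₁ equal = ⊥-elim (not-¬ equal (not-true-elim not-equal))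
    ...   | inj₂ (w , u≡w , wv) = subst (λ x → G x v ≡ true) (sym (eqF⇒≡ u≡w)) wv
    adjacent⇒at-one : G u v ≡ true → distAt G 1 u v ≡ true
    adjacent⇒at-one uv = ∧-true-intro (reach-snoc 0 u u v (reach-refl 0 u) uv) (cong not (≢⇒eqF (adjacent⇒≢ uv)))

  d-one : d G 1 ≡ length (edges G)
  d-one = begin
    d G 1                                         ≡⟨ d≡pairCount G 1 ⟩
    pairCount (Upper (distAt G 1))                ≡⟨ sum-cong-≗ (λ u → sum-cong-≗ (cong indicator ∘ upper u)) ⟩
    pairCount (λ u v → (toℕ u <ᵇ toℕ v) ∧ G u v)  ≡⟨ |edges|≡pairCount G ⟨
    length (edges G)                              ∎
    where
    open ≡-Reasoning
    upper : ∀ u v → Upper (distAt G 1) u v ≡ ((toℕ u <ᵇ toℕ v) ∧ G u v)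
    upper u v rewrite distAt-one u v = true-ext strict non-strict
      where
      strict : (toℕ u ≤ᵇ toℕ v) ∧ G u v ≡ true → (toℕ u <ᵇ toℕ v) ∧ G u v ≡ true
      strict h with ∧-true-elim (toℕ u ≤ᵇ toℕ v) (G u v) h
      ... | u≤v , uv =
        ∧-true-intro (<⇒<ᵇ≡true (≤∧≢⇒< (≤ᵇ≡true⇒≤ (toℕ u) (toℕ v) u≤v) (adjacent⇒≢ uv ∘ toℕ-injective))) uv
      non-strict : (toℕ u <ᵇ toℕ v) ∧ G u v ≡ true → (toℕ u ≤ᵇ toℕ v) ∧ G u v ≡ true
      non-strict h with ∧-true-elim (toℕ u <ᵇ toℕ v) (G u v) h
      ... | u<v , uv = ∧-true-intro (≤⇒≤ᵇ≡true (<⇒≤ (<ᵇ≡true⇒< (toℕ u) (toℕ v) u<v))) uv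

module Tree {n} (T : Graph n) (tree : IsTree T) where

  open Simple T (proj₁ tree) public
  open Distance T adjacent-sym (proj₁ (proj₂ tree)) public

  level-≢ : ∀ s {k w z} → dist s w ≡ k → k < dist s z → w ≢ z
  level-≢ s dw k<dz refl = <-irrefl (sym dw) k<dz

  -- Walk down from both ends of the path, one level at a time: the two ends either
  -- meet, closing a cycle, or stay distinct and give a longer path one level lower.
  no-path-above-level : ∀ s k {x y} (mid : List (Fin n)) → x ≢ y → dist s x ≡ k → dist s y ≡ k →
    All (λ z → k < dist s z) mid → Linked (Adj T) (x ∷ mid ++ [ y ]) → Unique (x ∷ mid ++ [ y ]) → ⊥
  no-path-above-level s zero {x} {y} mid x≢y dx dy _ _ _ = x≢y (trans (sym (dist≡0⇒≡ s x dx)) (dist≡0⇒≡ s y dy))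
  no-path-above-level s (suc k) {x} {y} mid x≢y dx dy above linked unique
    with dist-suc⇒predecessor s x dx | dist-suc⇒predecessor s y dy
  ... | x′ , x′x , dx′ | y′ , y′y , dy′ = close (x′ ≟ y′)
    where
    path : List (Fin n)
    path = x ∷ mid ++ [ y ]
    path-above : All (λ z → k < dist s z) path
    path-above = ≤-reflexive (sym dx) ∷ All.++⁺ (All.map (≤-trans (n≤1+n _)) above) (≤-reflexive (sym dy) ∷ [])
    x′∉path : All (x′ ≢_) path
    x′∉path = All.map (level-≢ s dx′) path-above
    close : Dec (x′ ≡ y′) → ⊥
    close (yes refl) = proj₂ (proj₂ tree)
      (x′ , path , 2≤length-∷-++-[_] x mid y , (x′∉path ∷ unique) ,
       (x′x ∷ Linked-snoc (x ∷ mid) linked (adjacent-sym x′ y y′y)))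
    close (no x′≢y′) = no-path-above-level s k path x′≢y′ dx′ dy′ path-above
      (x′x ∷ Linked-snoc (x ∷ mid) linked (adjacent-sym y′ y y′y))
      (All.++⁺ x′∉path (x′≢y′ ∷ []) ∷
       Unique-snoc unique (All.map (λ k<d → level-≢ s dy′ k<d ∘ sym) path-above))

  adjacent⇒dist≢ : ∀ s {a b} → T a b ≡ true → dist s a ≢ dist s b
  adjacent⇒dist≢ s {a} {b} ab da≡db =
    no-path-above-level s (dist s a) [] (adjacent⇒≢ ab) refl (sym da≡db) []
      (ab ∷ [-]) ((adjacent⇒≢ ab ∷ []) ∷ [] ∷ [])

  dist-adjacent : ∀ s {a b} → T a b ≡ true → dist s b ≡ suc (dist s a) ⊎ dist s a ≡ suc (dist s b)
  dist-adjacent s {a} {b} ab =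
    m≤1+n⇒n≤1+m⇒m≢n⇒n≡1+m⊎m≡1+n (dist-step s (adjacent-sym a b ab)) (dist-step s ab) (adjacent⇒dist≢ s ab)

  unique-predecessor : ∀ s {u w₁ w₂ k} → T u w₁ ≡ true → T u w₂ ≡ true →
    dist s u ≡ suc k → dist s w₁ ≡ k → dist s w₂ ≡ k → w₁ ≡ w₂
  unique-predecessor s {u} {w₁} {w₂} {k} uw₁ uw₂ du dw₁ dw₂ with w₁ ≟ w₂
  ... | yes w₁≡w₂ = w₁≡w₂
  ... | no  w₁≢w₂ = ⊥-elim (no-path-above-level s k (u ∷ []) w₁≢w₂ dw₁ dw₂ (≤-reflexive (sym du) ∷ [])
                              (adjacent-sym u w₁ uw₁ ∷ uw₂ ∷ [-])
                              ((w₁≢u ∷ w₁≢w₂ ∷ []) ∷ (u≢w₂ ∷ []) ∷ [] ∷ []))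
    where
    w₁≢u : w₁ ≢ u
    w₁≢u = level-≢ s dw₁ (≤-reflexive (sym du))
    u≢w₂ : u ≢ w₂
    u≢w₂ = level-≢ s dw₂ (≤-reflexive (sym du)) ∘ sym

  inner-ends-dist : ∀ {t u w v z} → T u w ≡ true → T v z ≡ true →
    dist u v ≡ suc (suc t) → dist w v ≡ suc t → dist z u ≡ suc t → dist w z ≡ t
  inner-ends-dist {t} {u} {w} {v} {z} uw vz duv dwv dzu
    with dist-adjacent z uw | dist-suc⇒predecessor u z (trans (dist-comm u z) dzu)
  ... | inj₂ dzu≡1+dzw | _ = trans (dist-comm w z) (suc-injective (trans (sym dzu≡1+dzw) dzu))
  ... | inj₁ dzw≡1+dzu | y , yz , duy =
    ⊥-elim (n≢2+n t (trans (sym duy) (trans (cong (dist u) y≡v) duv)))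
    where
    dwz : dist w z ≡ suc (suc t)
    dwz = trans (dist-comm w z) (trans dzw≡1+dzu (cong suc dzu))
    dwy : dist w y ≡ suc t
    dwy = ≤-antisym
      (subst (_≤ suc t) (dist-comm y w) (subst (λ d → dist y w ≤ suc d) (trans (dist-comm y u) duy) (dist-step y uw)))
      (≤-pred (subst (_≤ suc (dist w y)) dwz (dist-step w yz)))
    y≡v : y ≡ v
    y≡v = unique-predecessor w (adjacent-sym y z yz) (adjacent-sym v z vz) dwz dwy dwv

  dist-adjacent-away : ∀ s {a b k} → T a b ≡ true → dist s a ≡ k → k ≤ dist s b → dist s b ≡ suc k
  dist-adjacent-away s ab da k≤db with dist-adjacent s ab
  ... | inj₁ db≡1+da = trans db≡1+da (cong suc da)
  ... | inj₂ da≡1+db = ⊥-elim (1+n≰n (subst (_≤ dist s _) (trans (sym da) da≡1+db) k≤db))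

  edges-at-equal-distance-coincide : ∀ {t x x′ y y′} → T x x′ ≡ true → T y y′ ≡ true →
    dist x y ≡ t → dist x′ y′ ≡ t → dist x′ y ≡ suc t → dist x y′ ≡ suc t → x ≡ y × x′ ≡ y′
  edges-at-equal-distance-coincide {zero} {x} {x′} {y} {y′} _ _ dxy dx′y′ _ _ =
    dist≡0⇒≡ x y dxy , dist≡0⇒≡ x′ y′ dx′y′
  edges-at-equal-distance-coincide {suc t} {x} {x′} {y} {y′} xx′ yy′ dxy dx′y′ dx′y dxy′
    with dist-suc⇒predecessor x y dxy
  ... | p , py , dxp = ⊥-elim (n≢2+n t (trans (sym dxp) (trans (cong (dist x) p≡y′) dxy′)))
    where
    dx′p : dist x′ p ≡ suc t
    dx′p = ≤-antisym
      (subst₂ _≤_ (dist-comm p x′) (cong suc (trans (dist-comm p x) dxp)) (dist-step p xx′))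
      (≤-pred (subst (_≤ suc (dist x′ p)) dx′y (dist-step x′ py)))
    p≡y′ : p ≡ y′
    p≡y′ = unique-predecessor x′ (adjacent-sym p y py) yy′ dx′y dx′p dx′y′

-- Edges and the line graph

Joins : ∀ {n} → Fin n × Fin n → Fin n → Fin n → Set
Joins p u w = (proj₁ p ≡ u × proj₂ p ≡ w) ⊎ (proj₂ p ≡ u × proj₁ p ≡ w)

Endpoint : ∀ {n} → Fin n × Fin n → Fin n → Set
Endpoint p x = x ≡ proj₁ p ⊎ x ≡ proj₂ p

module _ {n} {p : Fin n × Fin n} where

  Joins-sym : ∀ {u w} → Joins p u w → Joins p w u
  Joins-sym (inj₁ (a , b)) = inj₂ (b , a)
  Joins-sym (inj₂ (a , b)) = inj₁ (b , a)

  joins⇒endpoint : ∀ {u w} → Joins p u w → Endpoint p u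
  joins⇒endpoint (inj₁ (a , _)) = inj₁ (sym a)
  joins⇒endpoint (inj₂ (a , _)) = inj₂ (sym a)

  endpoint⇒joins : ∀ {x} → Endpoint p x → ∃ λ x′ → Joins p x x′
  endpoint⇒joins (inj₁ x≡a) = proj₂ p , inj₁ (sym x≡a , refl)
  endpoint⇒joins (inj₂ x≡b) = proj₁ p , inj₂ (sym x≡b , refl)

  endpoint-of-joins : ∀ {u w x} → Joins p u w → Endpoint p x → x ≡ u ⊎ x ≡ w
  endpoint-of-joins (inj₁ (a , b)) (inj₁ x≡a) = inj₁ (trans x≡a a)
  endpoint-of-joins (inj₁ (a , b)) (inj₂ x≡b) = inj₂ (trans x≡b b)
  endpoint-of-joins (inj₂ (a , b)) (inj₁ x≡a) = inj₂ (trans x≡a b)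
  endpoint-of-joins (inj₂ (a , b)) (inj₂ x≡b) = inj₁ (trans x≡b a)

shareEnd⇒common-endpoint : ∀ {n} (p q : Fin n × Fin n) → shareEnd p q ≡ true → ∃ λ z → Endpoint p z × Endpoint q z
shareEnd⇒common-endpoint p q h with ∨-true-elim _ _ h
... | inj₁ a≡c = proj₁ p , inj₁ refl , inj₁ (eqF⇒≡ a≡c)
... | inj₂ h′ with ∨-true-elim _ _ h′
...   | inj₁ a≡e = proj₁ p , inj₁ refl , inj₂ (eqF⇒≡ a≡e)
...   | inj₂ h″ with ∨-true-elim _ _ h″
...     | inj₁ b≡c = proj₂ p , inj₂ refl , inj₁ (eqF⇒≡ b≡c)
...     | inj₂ b≡e = proj₂ p , inj₂ refl , inj₂ (eqF⇒≡ b≡e)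

common-endpoint⇒shareEnd : ∀ {n} (p q : Fin n × Fin n) {z} → Endpoint p z → Endpoint q z → shareEnd p q ≡ true
common-endpoint⇒shareEnd p q (inj₁ refl) (inj₁ z≡c) = ∨-true-introˡ _ (≡⇒eqF z≡c)
common-endpoint⇒shareEnd p q (inj₁ refl) (inj₂ z≡e) =
  ∨-true-introʳ (eqF (proj₁ p) (proj₁ q)) (∨-true-introˡ _ (≡⇒eqF z≡e))
common-endpoint⇒shareEnd p q (inj₂ refl) (inj₁ z≡c) =
  ∨-true-introʳ (eqF (proj₁ p) (proj₁ q)) (∨-true-introʳ (eqF (proj₁ p) (proj₂ q)) (∨-true-introˡ _ (≡⇒eqF z≡c)))
common-endpoint⇒shareEnd p q (inj₂ refl) (inj₂ z≡e) =
  ∨-true-introʳ (eqF (proj₁ p) (proj₁ q)) (∨-true-introʳ (eqF (proj₁ p) (proj₂ q))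
    (∨-true-introʳ (eqF (proj₂ p) (proj₁ q)) (≡⇒eqF z≡e)))

singleton?-All : ∀ {A : Set} {P : A → Set} c (x : A) → (c ≡ true → P x) → All P (if c then [ x ] else [])
singleton?-All true  x px = px refl ∷ []
singleton?-All false x px = []

singleton?-Unique : ∀ {A : Set} c (x : A) → Unique (if c then [ x ] else [])
singleton?-Unique true  x = [] ∷ []
singleton?-Unique false x = []

singleton?-Any : ∀ {A : Set} c (x : A) → c ≡ true → Any (_≡ x) (if c then [ x ] else [])
singleton?-Any true x refl = here refl

Unique-concatMap : ∀ {A B : Set} (tag : B → A) (g : A → List B) {xs} → Unique xs →
  (∀ x → Unique (g x)) → (∀ x → All (λ b → tag b ≡ x) (g x)) → Unique (concatMap g xs)
Unique-concatMap tag g {[]}     []                _        _      = []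
Unique-concatMap tag g {x ∷ xs} (x∉xs ∷ unique) unique-g tagged =
  AllPairs.++⁺ (unique-g x) (Unique-concatMap tag g unique unique-g tagged)
    (All.map (λ tag-b≡x → All.map (λ tag-c≢x b≡c → tag-c≢x (trans (cong tag (sym b≡c)) tag-b≡x)) rest-untagged)
             (tagged x))
  where
  rest-untagged : All (λ c → tag c ≢ x) (concatMap g xs)
  rest-untagged = All.concat⁺ (All.map⁺ {f = g}
    (All.map (λ {y} x≢y → All.map (λ tag≡y tag≡x → x≢y (trans (sym tag≡x) tag≡y)) (tagged y)) x∉xs))

lookup-injective : ∀ {A : Set} {xs : List A} → Unique xs → ∀ i j → lookup xs i ≡ lookup xs j → i ≡ j
lookup-injective (x∉xs ∷ _)      Fin.zero    Fin.zero    _ = refl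
lookup-injective (x∉xs ∷ _)      Fin.zero    (Fin.suc j) e = ⊥-elim (All.lookup x∉xs (∈-lookup j) e)
lookup-injective (x∉xs ∷ _)      (Fin.suc i) Fin.zero    e = ⊥-elim (All.lookup x∉xs (∈-lookup i) (sym e))
lookup-injective (_ ∷ unique)    (Fin.suc i) (Fin.suc j) e = cong Fin.suc (lookup-injective unique i j e)

module Edges {n} (G : Graph n) (simple : IsSimple G) where

  open Simple G simple

  m : ℕ
  m = length (edges G)

  edge : Fin m → Fin n × Fin n
  edge = lookup (edges G)

  candidate : Fin n → Fin n → List (Fin n × Fin n)
  candidate u v = if (toℕ u <ᵇ toℕ v) ∧ G u v then [ (u , v) ] else []

  IsEdge : Fin n × Fin n → Set
  IsEdge p = toℕ (proj₁ p) < toℕ (proj₂ p) × G (proj₁ p) (proj₂ p) ≡ true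

  edges-IsEdge : All IsEdge (edges G)
  edges-IsEdge = All.concat⁺ (All.map⁺ (All.tabulate⁺ λ u → All.concat⁺ (All.map⁺ (All.tabulate⁺ λ v →
    singleton?-All _ (u , v) (λ h → <ᵇ≡true⇒< (toℕ u) (toℕ v) (proj₁ (∧-true-elim _ _ h)) ,
                                    proj₂ (∧-true-elim _ _ h))))))

  edges-unique : Unique (edges G)
  edges-unique = Unique-concatMap proj₁ _ (allFin⁺ n)
    (λ u → Unique-concatMap proj₂ (candidate u) (allFin⁺ n) (λ v → singleton?-Unique _ (u , v))
                            (λ v → singleton?-All _ (u , v) (λ _ → refl)))
    (λ u → All.concat⁺ (All.map⁺ {f = candidate u} (All.tabulate⁺ (λ v → singleton?-All _ (u , v) (λ _ → refl)))))

  edge-IsEdge : ∀ i → IsEdge (edge i)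
  edge-IsEdge i = All.lookup edges-IsEdge (∈-lookup i)

  edge-index-ordered : ∀ {a b} → toℕ a < toℕ b → G a b ≡ true → ∃ λ i → edge i ≡ (a , b)
  edge-index-ordered {a} {b} a<b ab = Any.index listed , Any.lookup-index listed
    where
    listed : Any (_≡ (a , b)) (edges G)
    listed = Any.concatMap⁺ _ (Any.tabulate⁺ a (Any.concatMap⁺ (candidate a) (Any.tabulate⁺ b
               (singleton?-Any _ (a , b) (∧-true-intro (<⇒<ᵇ≡true a<b) ab)))))

  edge-index : ∀ {a b} → G a b ≡ true → ∃ λ i → Joins (edge i) a b
  edge-index {a} {b} ab with <-cmp (toℕ a) (toℕ b)
  ... | tri< a<b _ _ with edge-index-ordered a<b ab
  ...   | i , refl = i , inj₁ (refl , refl)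
  edge-index {a} {b} ab | tri> _ _ b<a with edge-index-ordered b<a (adjacent-sym a b ab)
  ...   | i , refl = i , inj₂ (refl , refl)
  edge-index {a} {b} ab | tri≈ _ a≡b _ = ⊥-elim (adjacent⇒≢ ab (toℕ-injective a≡b))

  joins⇒adjacent : ∀ i {u w} → Joins (edge i) u w → G u w ≡ true
  joins⇒adjacent i (inj₁ (refl , refl)) = proj₂ (edge-IsEdge i)
  joins⇒adjacent i (inj₂ (refl , refl)) = adjacent-sym _ _ (proj₂ (edge-IsEdge i))

  joins-injective : ∀ i j {u w} → Joins (edge i) u w → Joins (edge j) u w → i ≡ j
  joins-injective i j (inj₁ (a , b)) (inj₁ (c , d)) =
    lookup-injective edges-unique i j (cong₂ _,_ (trans a (sym c)) (trans b (sym d)))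
  joins-injective i j (inj₂ (a , b)) (inj₂ (c , d)) =
    lookup-injective edges-unique i j (cong₂ _,_ (trans b (sym d)) (trans a (sym c)))
  joins-injective i j (inj₁ (refl , refl)) (inj₂ (c , d)) =
    ⊥-elim (<-asym (proj₁ (edge-IsEdge i)) (subst₂ (λ x y → toℕ x < toℕ y) d c (proj₁ (edge-IsEdge j))))
  joins-injective i j (inj₂ (refl , refl)) (inj₁ (c , d)) =
    ⊥-elim (<-asym (proj₁ (edge-IsEdge i)) (subst₂ (λ x y → toℕ x < toℕ y) c d (proj₁ (edge-IsEdge j))))

  endpoints-adjacent : ∀ i {y z} → Endpoint (edge i) y → Endpoint (edge i) z → y ≢ z → G y z ≡ true
  endpoints-adjacent i y∈i z∈i y≢z with endpoint⇒joins y∈i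
  ... | y′ , joins with endpoint-of-joins joins z∈i
  ...   | inj₁ z≡y  = ⊥-elim (y≢z (sym z≡y))
  ...   | inj₂ refl = joins⇒adjacent i joins

  L-adjacent⇒ : ∀ i j → L G i j ≡ true → i ≢ j × ∃ λ z → Endpoint (edge i) z × Endpoint (edge j) z
  L-adjacent⇒ i j h with ∧-true-elim _ _ h
  ... | distinct , share = (λ i≡j → not-¬ (≡⇒eqF i≡j) (not-true-elim distinct)) , shareEnd⇒common-endpoint _ _ share

  L-adjacent : ∀ i j {z} → i ≢ j → Endpoint (edge i) z → Endpoint (edge j) z → L G i j ≡ true
  L-adjacent i j i≢j z∈i z∈j = ∧-true-intro (cong not (≢⇒eqF i≢j)) (common-endpoint⇒shareEnd _ _ z∈i z∈j)

  L-adjacent-sym : ∀ i j → L G i j ≡ true → L G j i ≡ true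
  L-adjacent-sym i j h with L-adjacent⇒ i j h
  ... | i≢j , z , z∈i , z∈j = L-adjacent j i (i≢j ∘ sym) z∈j z∈i

  open Walks G
  module L-Walks = Walks (L G)

  reach-L⇒reach : ∀ ℓ i j → reach (L G) (suc ℓ) i j ≡ true →
    ∃₂ λ x y → Endpoint (edge i) x × Endpoint (edge j) y × reach G ℓ x y ≡ true
  reach-L⇒reach zero i j r with L-Walks.reach-suc⁻ 0 i j r
  ... | inj₁ i≡j with eqF⇒≡ i≡j
  ...   | refl = proj₁ (edge i) , proj₁ (edge i) , inj₁ refl , inj₁ refl , reach-refl 0 _
  reach-L⇒reach zero i j r | inj₂ (h , i≡h , hj) with eqF⇒≡ i≡h | L-adjacent⇒ h j hj
  ...   | refl | _ , z , z∈i , z∈j = z , z , z∈i , z∈j , reach-refl 0 z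
  reach-L⇒reach (suc ℓ) i j r with L-Walks.reach-suc⁻ (suc ℓ) i j r
  ... | inj₁ short with reach-L⇒reach ℓ i j short
  ...   | x , y , x∈i , y∈j , rxy = x , y , x∈i , y∈j , reach-suc ℓ x y rxy
  reach-L⇒reach (suc ℓ) i j r | inj₂ (h , ih , hj) with reach-L⇒reach ℓ i h ih | L-adjacent⇒ h j hj
  ... | x , y , x∈i , y∈h , rxy | _ , z , z∈h , z∈j with y ≟ z
  ...   | yes refl = x , y , x∈i , z∈j , reach-suc ℓ x y rxy
  ...   | no  y≢z  = x , z , x∈i , z∈j , reach-snoc ℓ x y z rxy (endpoints-adjacent h y∈h z∈h y≢z)

  reach⇒reach-L : ∀ ℓ i j {x y} → Endpoint (edge i) x → Endpoint (edge j) y → reach G ℓ x y ≡ true →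
    reach (L G) (suc ℓ) i j ≡ true
  reach⇒reach-L zero i j x∈i y∈j r with eqF⇒≡ r
  ... | refl = equal-or-adjacent (i ≟ j)
    where
    equal-or-adjacent : Dec (i ≡ j) → reach (L G) 1 i j ≡ true
    equal-or-adjacent (yes refl) = L-Walks.reach-refl 1 i
    equal-or-adjacent (no i≢j)   = L-Walks.reach-snoc 0 i i j (L-Walks.reach-refl 0 i) (L-adjacent i j i≢j x∈i y∈j)
  reach⇒reach-L (suc ℓ) i j {x} {y} x∈i y∈j r with reach-suc⁻ ℓ x y r
  ... | inj₁ short = L-Walks.reach-suc (suc ℓ) i j (reach⇒reach-L ℓ i j x∈i y∈j short)
  ... | inj₂ (w , rw , wy) with edge-index wy
  ...   | h , joins = last-step (h ≟ j)
    where
    reach-h : reach (L G) (suc ℓ) i h ≡ true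
    reach-h = reach⇒reach-L ℓ i h x∈i (joins⇒endpoint joins) rw
    last-step : Dec (h ≡ j) → reach (L G) (suc (suc ℓ)) i j ≡ true
    last-step (yes refl) = L-Walks.reach-suc (suc ℓ) i h reach-h
    last-step (no h≢j)   =
      L-Walks.reach-snoc (suc ℓ) i h j reach-h (L-adjacent h j h≢j (joins⇒endpoint (Joins-sym joins)) y∈j)

-- The line graph of a tree

module LineGraphOfTree {n} (T : Graph n) (tree : IsTree T) where

  open Tree T tree
  open Edges T (proj₁ tree)

  reach-L-false⇒≢ : ∀ t i j → reach (L T) t i j ≡ false → i ≢ j
  reach-L-false⇒≢ t i j unreachable refl = not-¬ (L-Walks.reach-refl t i) unreachable

  reach-L-false⇒endpoint-dist-≥ : ∀ t i j → reach (L T) t i j ≡ false →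
    ∀ {x y} → Endpoint (edge i) x → Endpoint (edge j) y → t ≤ dist x y
  reach-L-false⇒endpoint-dist-≥ zero    i j unreachable x∈i y∈j = z≤n
  reach-L-false⇒endpoint-dist-≥ (suc t) i j unreachable {x} {y} x∈i y∈j with dist x y ≤? t
  ... | yes d≤t = ⊥-elim (not-¬ (reach⇒reach-L t i j x∈i y∈j (dist≤⇒reach x y d≤t)) unreachable)
  ... | no  d≰t = ≰⇒> d≰t

  endpoint-dist-≥⇒reach-L-false : ∀ t i j → i ≢ j →
    (∀ {x y} → Endpoint (edge i) x → Endpoint (edge j) y → t ≤ dist x y) → reach (L T) t i j ≡ false
  endpoint-dist-≥⇒reach-L-false zero    i j i≢j far = ≢⇒eqF i≢j
  endpoint-dist-≥⇒reach-L-false (suc t) i j i≢j far = ≢true⇒≡false reachable⇒⊥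
    where
    reachable⇒⊥ : reach (L T) (suc t) i j ≢ true
    reachable⇒⊥ r with reach-L⇒reach t i j r
    ... | x , y , x∈i , y∈j , rxy = <⇒≱ (s≤s (reach⇒dist≤ x y rxy)) (far x∈i y∈j)

  module _ (t : ℕ) where

    firstEdge : Fin n → Fin n → Fin n × Fin n → Bool
    firstEdge u v p = (eqF (proj₁ p) u ∧ distAt T (suc t) (proj₂ p) v)
                    ∨ (eqF (proj₂ p) u ∧ distAt T (suc t) (proj₁ p) v)

    -- i and j are the edges at the two ends of the path from u to v, of length t + 2
    endEdges : Fin n → Fin n → Fin m → Fin m → Bool
    endEdges u v i j = distAt T (suc (suc t)) u v ∧ (firstEdge u v (edge i) ∧ firstEdge v u (edge j))

    record EndEdges (u v : Fin n) (i j : Fin m) : Set where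
      field
        dist-uv : dist u v ≡ suc (suc t)
        w       : Fin n
        i-joins : Joins (edge i) u w
        dist-wv : dist w v ≡ suc t
        z       : Fin n
        j-joins : Joins (edge j) v z
        dist-zu : dist z u ≡ suc t

      dist-wz : dist w z ≡ t
      dist-wz = inner-ends-dist (joins⇒adjacent i i-joins) (joins⇒adjacent j j-joins) dist-uv dist-wv dist-zu

    firstEdge⇒ : ∀ u v p → firstEdge u v p ≡ true → ∃ λ w → Joins p u w × dist w v ≡ suc t
    firstEdge⇒ u v p h with ∨-true-elim _ _ h
    ... | inj₁ h₁ with ∧-true-elim _ _ h₁
    ...   | a≡u , at = proj₂ p , inj₁ (eqF⇒≡ a≡u , refl) , distAt⇒dist≡ (suc t) _ v at
    firstEdge⇒ u v p h | inj₂ h₂ with ∧-true-elim _ _ h₂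
    ...   | b≡u , at = proj₁ p , inj₂ (eqF⇒≡ b≡u , refl) , distAt⇒dist≡ (suc t) _ v at

    ⇒firstEdge : ∀ u v {w} p → Joins p u w → dist w v ≡ suc t → firstEdge u v p ≡ true
    ⇒firstEdge u v p (inj₁ (a≡u , refl)) dwv =
      ∨-true-introˡ _ (∧-true-intro (≡⇒eqF a≡u) (dist≡⇒distAt (suc t) _ v dwv))
    ⇒firstEdge u v p (inj₂ (b≡u , refl)) dwv =
      ∨-true-introʳ (eqF (proj₁ p) u ∧ distAt T (suc t) (proj₂ p) v)
                    (∧-true-intro (≡⇒eqF b≡u) (dist≡⇒distAt (suc t) _ v dwv))

    module E = EndEdges

    endEdges⇒ : ∀ u v i j → endEdges u v i j ≡ true → EndEdges u v i j
    endEdges⇒ u v i j h with ∧-true-elim _ _ h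
    ... | at , h′ with ∧-true-elim _ _ h′
    ...   | fi , fj with firstEdge⇒ u v (edge i) fi | firstEdge⇒ v u (edge j) fj
    ...     | w , i-joins , dwv | z , j-joins , dzu =
      record { dist-uv = distAt⇒dist≡ (suc (suc t)) u v at ; i-joins = i-joins ; dist-wv = dwv
             ; j-joins = j-joins ; dist-zu = dzu }

    ⇒endEdges : ∀ {u v i j} → EndEdges u v i j → endEdges u v i j ≡ true
    ⇒endEdges {u} {v} {i} {j} e = ∧-true-intro (dist≡⇒distAt (suc (suc t)) u v dist-uv)
      (∧-true-intro (⇒firstEdge u v (edge i) i-joins dist-wv) (⇒firstEdge v u (edge j) j-joins dist-zu))
      where open EndEdges e

    vertex-pair-witness : ∀ u v → dist u v ≡ suc (suc t) → UniqueWitness (endEdges u v)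
    vertex-pair-witness u v duv
      with dist-suc⇒predecessor v u (trans (dist-comm v u) duv) | dist-suc⇒predecessor u v duv
    ... | w₀ , w₀u , dvw₀ | z₀ , z₀v , duz₀
      with edge-index (adjacent-sym w₀ u w₀u) | edge-index (adjacent-sym z₀ v z₀v)
    ...   | i₀ , i₀-joins | j₀ , j₀-joins = i₀ , j₀ , ⇒endEdges e₀ , unique
      where
      e₀ : EndEdges u v i₀ j₀
      e₀ = record { dist-uv = duv ; i-joins = i₀-joins ; dist-wv = trans (dist-comm w₀ v) dvw₀
                  ; j-joins = j₀-joins ; dist-zu = trans (dist-comm z₀ u) duz₀ }
      unique : ∀ i j → endEdges u v i j ≡ true → i ≡ i₀ × j ≡ j₀
      unique i j h = joins-injective i i₀ (subst (Joins (edge i) u) w≡w₀ i-joins) i₀-joins ,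
                     joins-injective j j₀ (subst (Joins (edge j) v) z≡z₀ j-joins) j₀-joins
        where
        open EndEdges (endEdges⇒ u v i j h)
        w≡w₀ : w ≡ w₀
        w≡w₀ = unique-predecessor v (joins⇒adjacent i i-joins) (adjacent-sym w₀ u w₀u)
                 (trans (dist-comm v u) duv) (trans (dist-comm v w) dist-wv) dvw₀
        z≡z₀ : z ≡ z₀
        z≡z₀ = unique-predecessor u (joins⇒adjacent j j-joins) (adjacent-sym z₀ v z₀v)
                 duv (trans (dist-comm u z) dist-zu) duz₀

    endEdges-of-vertex-pair : ∀ u v → pairCount (endEdges u v) ≡ indicator (distAt T (suc (suc t)) u v)
    endEdges-of-vertex-pair u v = pairCount-indicator (endEdges u v) (distAt T (suc (suc t)) u v)
      (λ i j h → proj₁ (∧-true-elim _ _ h))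
      (λ at → vertex-pair-witness u v (distAt⇒dist≡ (suc (suc t)) u v at))

    endEdges⇒distAt-L : ∀ {u v i j} → EndEdges u v i j → distAt (L T) (suc t) i j ≡ true
    endEdges⇒distAt-L {u} {v} {i} {j} e = ∧-true-intro reachable (cong not unreachable)
      where
      open EndEdges e
      reachable : reach (L T) (suc t) i j ≡ true
      reachable = reach⇒reach-L t i j (joins⇒endpoint (Joins-sym i-joins))
                    (joins⇒endpoint (Joins-sym j-joins)) (dist≤⇒reach w z (≤-reflexive dist-wz))
      far : ∀ {x y} → Endpoint (edge i) x → Endpoint (edge j) y → t ≤ dist x y
      far x∈i y∈j with endpoint-of-joins i-joins x∈i | endpoint-of-joins j-joins y∈j
      ... | inj₁ refl | inj₁ refl = subst (t ≤_) (sym dist-uv) (≤-trans (n≤1+n t) (n≤1+n (suc t)))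
      ... | inj₁ refl | inj₂ refl = subst (t ≤_) (sym (trans (dist-comm u z) dist-zu)) (n≤1+n t)
      ... | inj₂ refl | inj₁ refl = subst (t ≤_) (sym dist-wv) (n≤1+n t)
      ... | inj₂ refl | inj₂ refl = ≤-reflexive (sym dist-wz)
      i≢j : i ≢ j
      i≢j i≡j
        with endpoint-of-joins i-joins (joins⇒endpoint (subst (λ k → Joins (edge k) v z) (sym i≡j) j-joins))
      ... | inj₁ refl = 0≢1+n (trans (sym (dist-refl u)) dist-uv)
      ... | inj₂ refl = 0≢1+n (trans (sym (dist-refl w)) dist-wv)
      unreachable : reach (L T) t i j ≡ false
      unreachable = endpoint-dist-≥⇒reach-L-false t i j i≢j far

    edge-pair-unique : ∀ {u v u′ v′ i j} → EndEdges u v i j → EndEdges u′ v′ i j → u′ ≡ u × v′ ≡ v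
    edge-pair-unique {u} {v} e e′
      with endpoint-of-joins (E.i-joins e) (joins⇒endpoint (E.i-joins e′))
         | endpoint-of-joins (E.j-joins e) (joins⇒endpoint (E.j-joins e′))
    ... | inj₁ u′≡u | inj₁ v′≡v = u′≡u , v′≡v
    ... | inj₁ refl | inj₂ refl =
      ⊥-elim (1+n≢n (trans (sym (E.dist-uv e′)) (trans (dist-comm u (E.z e)) (E.dist-zu e))))
    ... | inj₂ refl | inj₁ refl = ⊥-elim (1+n≢n (trans (sym (E.dist-uv e′)) (E.dist-wv e)))
    ... | inj₂ refl | inj₂ refl = ⊥-elim (n≢2+n t (trans (sym (E.dist-wz e)) (E.dist-uv e′)))

    distAt-L⇒endEdges : ∀ i j → distAt (L T) (suc t) i j ≡ true → ∃₂ λ u v → EndEdges u v i j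
    distAt-L⇒endEdges i j at with ∧-true-elim (reach (L T) (suc t) i j) (not (reach (L T) t i j)) at
    ... | reachable , not-unreachable with reach-L⇒reach t i j reachable
    ...   | x , y , x∈i , y∈j , rxy with endpoint⇒joins x∈i | endpoint⇒joins y∈j
    ...     | x′ , x-joins | y′ , y-joins = x′ , y′ ,
      record { dist-uv = dx′y′ ; i-joins = Joins-sym x-joins ; dist-wv = dxy′
             ; j-joins = Joins-sym y-joins ; dist-zu = trans (dist-comm y x′) dx′y }
      where
      unreachable : reach (L T) t i j ≡ false
      unreachable = not-true-elim not-unreachable
      far : ∀ {a b} → Endpoint (edge i) a → Endpoint (edge j) b → t ≤ dist a b
      far = reach-L-false⇒endpoint-dist-≥ t i j unreachable
      xx′ : T x x′ ≡ true
      xx′ = joins⇒adjacent i x-joins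
      yy′ : T y y′ ≡ true
      yy′ = joins⇒adjacent j y-joins
      dxy : dist x y ≡ t
      dxy = ≤-antisym (reach⇒dist≤ x y rxy) (far x∈i y∈j)
      dxy′ : dist x y′ ≡ suc t
      dxy′ = dist-adjacent-away x yy′ dxy (far x∈i (joins⇒endpoint (Joins-sym y-joins)))
      dx′y : dist x′ y ≡ suc t
      dx′y = trans (dist-comm x′ y) (dist-adjacent-away y xx′ (trans (dist-comm y x) dxy)
               (subst (t ≤_) (dist-comm x′ y) (far (joins⇒endpoint (Joins-sym x-joins)) y∈j)))
      dx′y′ : dist x′ y′ ≡ suc (suc t)
      dx′y′ with dist-adjacent x′ yy′
      ... | inj₁ dx′y′≡1+dx′y = trans dx′y′≡1+dx′y (cong suc dx′y)
      ... | inj₂ dx′y≡1+dx′y′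
        with edges-at-equal-distance-coincide xx′ yy′ dxy
               (suc-injective (trans (sym dx′y≡1+dx′y′) dx′y)) dx′y dxy′
      ...   | refl , refl = ⊥-elim (reach-L-false⇒≢ t i j unreachable (joins-injective i j x-joins y-joins))

    endEdges-of-edge-pair : ∀ i j →
      pairCount (λ u v → endEdges u v i j) ≡ indicator (distAt (L T) (suc t) i j)
    endEdges-of-edge-pair i j = pairCount-indicator (λ u v → endEdges u v i j) (distAt (L T) (suc t) i j)
      (λ u v h → endEdges⇒distAt-L (endEdges⇒ u v i j h)) witness
      where
      unique-endEdges : (∃₂ λ u v → EndEdges u v i j) → UniqueWitness (λ u v → endEdges u v i j)
      unique-endEdges (u , v , e) =
        u , v , ⇒endEdges e , λ u′ v′ h → edge-pair-unique e (endEdges⇒ u′ v′ i j h)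
      witness : distAt (L T) (suc t) i j ≡ true → UniqueWitness (λ u v → endEdges u v i j)
      witness at = unique-endEdges (distAt-L⇒endEdges i j at)

  d-suc-suc : ∀ t → d T (suc (suc t)) ≡ d (L T) (suc t)
  d-suc-suc t = *-cancelˡ-≡ _ _ 2 (begin
    2 * d T (suc (suc t))               ≡⟨ T-Symmetric.pairCount-distAt≡2*d (suc t) ⟨
    pairCount (distAt T (suc (suc t)))  ≡⟨ pairCount-double-counting _ _ (endEdges t)
                                             (endEdges-of-vertex-pair t) (endEdges-of-edge-pair t) ⟩
    pairCount (distAt (L T) (suc t))    ≡⟨ L-Symmetric.pairCount-distAt≡2*d t ⟩
    2 * d (L T) (suc t)                 ∎)
    where
    open ≡-Reasoning
    module T-Symmetric = Walks.Symmetric T adjacent-sym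
    module L-Symmetric = Walks.Symmetric (L T) L-adjacent-sym

theorem2 : (n : ℕ) (T : Graph n) → IsTree T →
    ∀ k → H T k ≡ (X* (He T) +C n) k
theorem2 n T tree zero          = d-zero T
theorem2 n T tree (suc zero)    = trans (Simple.d-one T (proj₁ tree)) (sym (d-zero (L T)))
theorem2 n T tree (suc (suc t)) = LineGraphOfTree.d-suc-suc T tree t
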